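{- Let $\mathsf{LtoBw}$ and $\mathsf{BwtoL}$ be the maps defined in the context. Then $\mathsf{BwtoL}\circ\mathsf{LtoBw}$ is the identity on the set of lambda terms, and $\mathsf{LtoBw}\circ\mathsf{BwtoL}$ is the identity on the set of black-white trees.
   Context: Lambda terms in de Bruijn notation are generated by $M ::= \underline{0} \mid S\,n \mid \lambda M \mid M\,M$ with de Bruijn indices $n ::= \underline{0} \mid S\,n$ (terms need not be closed). A black-white tree is a finite nonempty rooted binary tree (each node has an optional left child and an optional right child, distinguished) whose nodes are colored black or white, such that: the root is black; a black node has no right child; a white node never has a black left child. (Thus the allowed parent–child relations are: black with left child black or white; white with left child white; white with right child black.) The leftmost node of a tree is obtained by starting at the root and repeatedly moving to the left child until a node without left child is reached. $\mathsf{LtoBw}$ from lambda terms to black-white trees: $\mathsf{LtoBw}(\underline{0})$ is a single black node; $\mathsf{LtoBw}(S\,n)$ is obtained from $\mathsf{LtoBw}(n)$ by adding a new black node as left child of its leftmost node; $\mathsf{LtoBw}(\lambda M)$ is obtained from $\mathsf{LtoBw}(M)$ by adding a new white node as left child of its leftmost node; $\mathsf{LtoBw}(M_1 M_2)$ is obtained from $\mathsf{LtoBw}(M_2)$ by adding a new white node as left child of its leftmost node and attaching $\mathsf{LtoBw}(M_1)$ as the right subtree of this new white node. $\mathsf{BwtoL}$ from black-white trees to lambda terms: if the leftmost node of $T$ is black, then $T$ is a chain of $k$ black nodes (each the left child of the previous) and $\mathsf{BwtoL}(T) = S^{k-1}\underline{0}$; if the leftmost node is white with no right child, and $T'$ is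 $T$ with this node removed, then $\mathsf{BwtoL}(T) = \lambda\,\mathsf{BwtoL}(T')$; if the leftmost node is white with right subtree $T_1$, and $T_2$ is $T$ with this node and its right subtree removed, then $\mathsf{BwtoL}(T) = \mathsf{BwtoL}(T_1)\,\mathsf{BwtoL}(T_2)$. -}

module Defs where

open import Data.Nat using (ℕ; zero; suc; _+_; _∸_)
open import Data.Maybe using (Maybe; just; nothing)
open import Data.Product using (_×_; _,_)
open import Data.Unit using (⊤)
open import Data.Empty using (⊥)
open import Relation.Binary.PropositionalEquality using (_≡_)

-- Lambda terms in de Bruijn notation.
-- A de Bruijn index  S^n 0  is represented by the natural number n,
-- so  M ::= 0 | S n | λ M | M M  becomes  var n | lam M | app M M.

data Term : Set where
  var : ℕ → Term
  lam : Term → Term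
  app : Term → Term → Term

-- Finite rooted binary trees with coloured nodes.  'leaf' stands for an
-- absent child (empty tree); a nonempty tree is a 'node c l r' with
-- left subtree l and right subtree r.

data Color : Set where
  black white : Color

data BT : Set where
  leaf : BT
  node : Color → BT → BT → BT

LeftOK : Color → BT → Set
LeftOK _     leaf           = ⊤
LeftOK black (node _ _ _)   = ⊤
LeftOK white (node c _ _)   = c ≡ white

RightOK : Color → BT → Set
RightOK _     leaf          = ⊤
RightOK black (node _ _ _)  = ⊥
RightOK white (node c _ _)  = c ≡ black

WellColored : BT → Set
WellColored leaf           = ⊤
WellColored (node c l r)   = LeftOK c l × RightOK c r × WellColored l × WellColored r

RootBlack : BT → Set
RootBlack leaf               = ⊥
RootBlack (node black _ _)   = ⊤
RootBlack (node white _ _)   = ⊥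

IsBW : BT → Set
IsBW t = RootBlack t × WellColored t

size : BT → ℕ
size leaf         = 0
size (node _ l r) = suc (size l + size r)

addLeftmost : BT → BT → BT
addLeftmost x leaf                      = x
addLeftmost x (node c leaf r)           = node c x r
addLeftmost x (node c l@(node _ _ _) r) = node c (addLeftmost x l) r

leftmost : BT → Maybe (Color × BT)
leftmost leaf                      = nothing
leftmost (node c leaf r)           = just (c , r)
leftmost (node c l@(node _ _ _) r) = leftmost l

removeLeftmost : BT → BT
removeLeftmost leaf                      = leaf
removeLeftmost (node c leaf r)           = leaf
removeLeftmost (node c l@(node _ _ _) r) = node c (removeLeftmost l) r

single : Color → BT
single c = node c leaf leaf

LtoBw : Term → BT
LtoBw (var zero)    = single black
LtoBw (var (suc n)) = addLeftmost (single black) (LtoBw (var n))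
LtoBw (lam M)       = addLeftmost (single white) (LtoBw M)
LtoBw (app M₁ M₂)   = addLeftmost (node white leaf (LtoBw M₁)) (LtoBw M₂)

-- BwtoL, defined literally by the three cases of the paper, by recursion
-- on a fuel parameter (the number of nodes; every recursive call is on a
-- strictly smaller tree, so this fuel never runs out on nonempty trees).
-- Junk value 'var 0' for the empty tree / exhausted fuel.

BwtoL-fuel : ℕ → BT → Term
BwtoL-fuel zero    _ = var 0
BwtoL-fuel (suc f) t with leftmost t
... | nothing                     = var 0
... | just (black , _)            = var (size t ∸ 1)   -- chain of k = size t black nodes: S^(k-1) 0
... | just (white , leaf)         = lam (BwtoL-fuel f (removeLeftmost t))
... | just (white , r@(node _ _ _)) = app (BwtoL-fuel f r) (BwtoL-fuel f (removeLeftmost t))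

BwtoL : BT → Term
BwtoL t = BwtoL-fuel (size t) t

module Submission where

open import Defs
open import Data.Nat using (ℕ; zero; suc; _+_; _∸_; _≤_; s≤s)
open import Data.Nat.Properties using (+-identityʳ; +-suc; +-assoc; m≤m+n; m≤n+m; ≤-trans; ≤-refl)
open import Data.Maybe using (just; nothing)
open import Data.Product using (_×_; _,_; Σ; proj₁; proj₂)
open import Data.Empty using (⊥-elim)
open import Function using (_∘_)
open import Relation.Binary.PropositionalEquality

-- Adding a node with colour c and right subtree r at the leftmost position,
-- and removing the leftmost node together with its right subtree, are mutually
-- inverse.  Hence BwtoL satisfies the equations lam and app that mirror the
-- clauses of LtoBw (once its fuel is shown irrelevant), so BwtoL ∘ LtoBw = id
-- by induction on terms.  Conversely every black-white tree is a black left
-- spine or such an addition applied to strictly smaller black-white trees, so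
-- LtoBw ∘ BwtoL = id by induction on size.

leftmost-addLeftmost : ∀ c l r t → leftmost (addLeftmost (node c l r) t) ≡ leftmost (node c l r)
leftmost-addLeftmost _ _ _ leaf                             = refl
leftmost-addLeftmost _ _ _ (node _ leaf _)                  = refl
leftmost-addLeftmost _ _ _ (node _ (node _ leaf _) _)       = refl
leftmost-addLeftmost c l r (node _ (node c′ l′@(node _ _ _) r′) _) =
  leftmost-addLeftmost c l r (node c′ l′ r′)

removeLeftmost-addLeftmost : ∀ c r t → removeLeftmost (addLeftmost (node c leaf r) t) ≡ t
removeLeftmost-addLeftmost _ _ leaf                       = refl
removeLeftmost-addLeftmost _ _ (node _ leaf _)            = refl
removeLeftmost-addLeftmost _ _ (node _ (node _ leaf _) _) = refl
removeLeftmost-addLeftmost c r (node c₀ (node c′ l′@(node _ _ _) r′) r₀) =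
  cong (λ t → node c₀ t r₀) (removeLeftmost-addLeftmost c r (node c′ l′ r′))

addLeftmost-removeLeftmost : ∀ T {c r} → leftmost T ≡ just (c , r) →
                             addLeftmost (node c leaf r) (removeLeftmost T) ≡ T
addLeftmost-removeLeftmost (node _ leaf _) refl = refl
addLeftmost-removeLeftmost (node c₀ l@(node _ _ _) r₀) eq
  with removeLeftmost l | addLeftmost-removeLeftmost l eq
... | leaf       | ih = cong (λ t → node c₀ t r₀) ih
... | node _ _ _ | ih = cong (λ t → node c₀ t r₀) ih

leftmost≡nothing⇒leaf : ∀ T → leftmost T ≡ nothing → T ≡ leaf
leftmost≡nothing⇒leaf leaf                        _  = refl
leftmost≡nothing⇒leaf (node c (node c′ l′ r′) r) eq with leftmost≡nothing⇒leaf (node c′ l′ r′) eq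
... | ()

addLeftmost-≢leaf : ∀ {x} t → x ≢ leaf → addLeftmost x t ≢ leaf
addLeftmost-≢leaf leaf                x≢leaf = x≢leaf
addLeftmost-≢leaf (node _ leaf _)       _    = λ ()
addLeftmost-≢leaf (node _ (node _ _ _) _) _  = λ ()

size-addLeftmost : ∀ x t → size (addLeftmost x t) ≡ size x + size t
size-addLeftmost x leaf            = sym (+-identityʳ (size x))
size-addLeftmost x (node _ leaf r) = sym (+-suc (size x) (size r))
size-addLeftmost x (node _ l@(node _ _ _) r) = begin
  suc (size (addLeftmost x l) + size r) ≡⟨ cong (λ n → suc (n + size r)) (size-addLeftmost x l) ⟩
  suc (size x + size l + size r)        ≡⟨ cong suc (+-assoc (size x) (size l) (size r)) ⟩
  suc (size x + (size l + size r))      ≡⟨ sym (+-suc (size x) (size l + size r)) ⟩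
  size x + suc (size l + size r)        ∎
  where open ≡-Reasoning

leftmost-parts-smaller : ∀ T {c r n} → leftmost T ≡ just (c , r) → size T ≤ suc n →
                         size r ≤ n × size (removeLeftmost T) ≤ n
leftmost-parts-smaller T {c} {r} eq T≤ with sizes
  where
  sizes : size T ≡ suc (size r + size (removeLeftmost T))
  sizes = trans (sym (cong size (addLeftmost-removeLeftmost T eq)))
                (size-addLeftmost (node c leaf r) (removeLeftmost T))
... | sizes with subst (_≤ _) sizes T≤
... | s≤s parts≤ = ≤-trans (m≤m+n _ _) parts≤ , ≤-trans (m≤n+m _ _) parts≤

BwtoL-fuel-leaf : ∀ f → BwtoL-fuel f leaf ≡ var 0
BwtoL-fuel-leaf zero    = refl
BwtoL-fuel-leaf (suc f) = refl

BwtoL-fuel-irrelevant : ∀ {f g} T → size T ≤ f → size T ≤ g → BwtoL-fuel f T ≡ BwtoL-fuel g T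
BwtoL-fuel-irrelevant {f} {g} leaf _ _ = trans (BwtoL-fuel-leaf f) (sym (BwtoL-fuel-leaf g))
BwtoL-fuel-irrelevant {suc f} {suc g} T@(node _ _ _) T≤f T≤g with leftmost T in eq
... | nothing           = refl
... | just (black , _)  = refl
... | just (white , leaf) =
  cong lam (BwtoL-fuel-irrelevant (removeLeftmost T)
    (proj₂ (leftmost-parts-smaller T eq T≤f)) (proj₂ (leftmost-parts-smaller T eq T≤g)))
... | just (white , r@(node _ _ _)) =
  cong₂ app
    (BwtoL-fuel-irrelevant r
      (proj₁ (leftmost-parts-smaller T eq T≤f)) (proj₁ (leftmost-parts-smaller T eq T≤g)))
    (BwtoL-fuel-irrelevant (removeLeftmost T)
      (proj₂ (leftmost-parts-smaller T eq T≤f)) (proj₂ (leftmost-parts-smaller T eq T≤g)))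

BwtoL-fuel-sufficient : ∀ {f} T → size T ≤ f → BwtoL-fuel f T ≡ BwtoL T
BwtoL-fuel-sufficient T T≤f = BwtoL-fuel-irrelevant T T≤f ≤-refl

size-addLeftmost-≤ : ∀ x t → size (addLeftmost x t) ≤ size x + size t
size-addLeftmost-≤ x t = subst (_≤ size x + size t) (sym (size-addLeftmost x t)) ≤-refl

BwtoL-lam : ∀ t → BwtoL (addLeftmost (single white) t) ≡ lam (BwtoL t)
BwtoL-lam t = begin
  BwtoL T                          ≡⟨ sym (BwtoL-fuel-sufficient T (size-addLeftmost-≤ (single white) t)) ⟩
  BwtoL-fuel (suc (size t)) T      ≡⟨ unfold (leftmost-addLeftmost white leaf leaf t) ⟩
  lam (BwtoL-fuel (size t) (removeLeftmost T))
                                   ≡⟨ cong (lam ∘ BwtoL-fuel (size t)) (removeLeftmost-addLeftmost white leaf t) ⟩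
  lam (BwtoL t)                    ∎
  where
  open ≡-Reasoning
  T = addLeftmost (single white) t
  unfold : leftmost T ≡ just (white , leaf) →
           BwtoL-fuel (suc (size t)) T ≡ lam (BwtoL-fuel (size t) (removeLeftmost T))
  unfold eq rewrite eq = refl

BwtoL-app : ∀ r t → r ≢ leaf → BwtoL (addLeftmost (node white leaf r) t) ≡ app (BwtoL r) (BwtoL t)
BwtoL-app leaf _ r≢leaf = ⊥-elim (r≢leaf refl)
BwtoL-app r@(node _ _ _) t _ = begin
  BwtoL T                          ≡⟨ sym (BwtoL-fuel-sufficient T (size-addLeftmost-≤ (node white leaf r) t)) ⟩
  BwtoL-fuel (suc n) T             ≡⟨ unfold (leftmost-addLeftmost white leaf r t) ⟩
  app (BwtoL-fuel n r) (BwtoL-fuel n (removeLeftmost T))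
                                   ≡⟨ cong (app (BwtoL-fuel n r) ∘ BwtoL-fuel n) (removeLeftmost-addLeftmost white r t) ⟩
  app (BwtoL-fuel n r) (BwtoL-fuel n t)
                                   ≡⟨ cong₂ app (BwtoL-fuel-sufficient r (m≤m+n _ _))
                                                (BwtoL-fuel-sufficient t (m≤n+m _ _)) ⟩
  app (BwtoL r) (BwtoL t)          ∎
  where
  open ≡-Reasoning
  T = addLeftmost (node white leaf r) t
  n = size r + size t
  unfold : leftmost T ≡ just (white , r) →
           BwtoL-fuel (suc n) T ≡ app (BwtoL-fuel n r) (BwtoL-fuel n (removeLeftmost T))
  unfold eq rewrite eq = refl

spine : ℕ → BT
spine zero    = leaf
spine (suc k) = node black (spine k) leaf

size-spine : ∀ k → size (spine k) ≡ k
size-spine zero    = refl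
size-spine (suc k) = cong suc (trans (+-identityʳ _) (size-spine k))

addLeftmost-spine : ∀ k → addLeftmost (single black) (spine k) ≡ spine (suc k)
addLeftmost-spine zero          = refl
addLeftmost-spine (suc zero)    = refl
addLeftmost-spine (suc (suc k)) = cong (λ t → node black t leaf) (addLeftmost-spine (suc k))

LtoBw-var : ∀ n → LtoBw (var n) ≡ spine (suc n)
LtoBw-var zero    = refl
LtoBw-var (suc n) = trans (cong (addLeftmost (single black)) (LtoBw-var n)) (addLeftmost-spine (suc n))

leftmost-spine : ∀ k → leftmost (spine (suc k)) ≡ just (black , leaf)
leftmost-spine zero          = refl
leftmost-spine (suc zero)    = refl
leftmost-spine (suc (suc k)) = leftmost-spine (suc k)

BwtoL-spine : ∀ k → BwtoL (spine (suc k)) ≡ var k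
BwtoL-spine k rewrite leftmost-spine k = cong (var ∘ (_∸ 1)) (size-spine (suc k))

-- A white node never has a black left child, so a black leftmost node
-- forces the whole left spine to be black, and black nodes have no right child.
blackLeftmost⇒spine : ∀ T {r} → WellColored T → leftmost T ≡ just (black , r) →
                      Σ ℕ λ k → T ≡ spine (suc k)
blackLeftmost⇒spine (node .black leaf leaf)         _            refl = zero , refl
blackLeftmost⇒spine (node .black leaf (node _ _ _)) (_ , () , _) refl
blackLeftmost⇒spine (node c l@(node _ _ _) r) (l-ok , r-ok , wc-l , _) eq
  with blackLeftmost⇒spine l wc-l eq
blackLeftmost⇒spine (node black _ leaf)         _            _ | k , refl = suc k , refl
blackLeftmost⇒spine (node black _ (node _ _ _)) (_ , () , _) _ | _ , refl
blackLeftmost⇒spine (node white _ _)            (() , _)     _ | _ , refl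

LeftOK-removeLeftmost : ∀ c l → LeftOK c l → LeftOK c (removeLeftmost l)
LeftOK-removeLeftmost black leaf                    _ = _
LeftOK-removeLeftmost white leaf                    _ = _
LeftOK-removeLeftmost black (node _ leaf _)         _ = _
LeftOK-removeLeftmost white (node _ leaf _)         _ = _
LeftOK-removeLeftmost black (node _ (node _ _ _) _) _ = _
LeftOK-removeLeftmost white (node _ (node _ _ _) _) p = p

WellColored-removeLeftmost : ∀ T → WellColored T → WellColored (removeLeftmost T)
WellColored-removeLeftmost leaf                      _ = _
WellColored-removeLeftmost (node _ leaf _)           _ = _
WellColored-removeLeftmost (node c l@(node _ _ _) _) (l-ok , r-ok , wc-l , wc-r) =
  LeftOK-removeLeftmost c l l-ok , r-ok , WellColored-removeLeftmost l wc-l , wc-r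

IsBW-removeLeftmost : ∀ T {r} → IsBW T → leftmost T ≡ just (white , r) → IsBW (removeLeftmost T)
IsBW-removeLeftmost (node black leaf _) _ ()
IsBW-removeLeftmost T@(node black (node _ _ _) _) (_ , wc) _ = _ , WellColored-removeLeftmost T wc

IsBW-leftmostRight : ∀ T {c l r} → WellColored T → leftmost T ≡ just (white , node c l r) →
                     IsBW (node c l r)
IsBW-leftmostRight (node _ leaf _) (_ , refl , _ , wc-r) refl = _ , wc-r
IsBW-leftmostRight (node _ l@(node _ _ _) _) (_ , _ , wc-l , _) eq = IsBW-leftmostRight l wc-l eq

LtoBw-≢leaf : ∀ M → LtoBw M ≢ leaf
LtoBw-≢leaf (var zero)    = λ ()
LtoBw-≢leaf (var (suc n)) = addLeftmost-≢leaf (LtoBw (var n)) (λ ())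
LtoBw-≢leaf (lam M)       = addLeftmost-≢leaf (LtoBw M) (λ ())
LtoBw-≢leaf (app _ M₂)    = addLeftmost-≢leaf (LtoBw M₂) (λ ())

BwtoL∘LtoBw : ∀ M → BwtoL (LtoBw M) ≡ M
BwtoL∘LtoBw (var n)     = trans (cong BwtoL (LtoBw-var n)) (BwtoL-spine n)
BwtoL∘LtoBw (lam M)     = trans (BwtoL-lam (LtoBw M)) (cong lam (BwtoL∘LtoBw M))
BwtoL∘LtoBw (app M₁ M₂) = trans (BwtoL-app (LtoBw M₁) (LtoBw M₂) (LtoBw-≢leaf M₁))
                                (cong₂ app (BwtoL∘LtoBw M₁) (BwtoL∘LtoBw M₂))

LtoBw∘BwtoL-spine : ∀ k → LtoBw (BwtoL (spine (suc k))) ≡ spine (suc k)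
LtoBw∘BwtoL-spine k = trans (cong LtoBw (BwtoL-spine k)) (LtoBw-var k)

LtoBw∘BwtoL-bounded : ∀ n T → size T ≤ n → IsBW T → LtoBw (BwtoL T) ≡ T
LtoBw∘BwtoL-bounded _       leaf _  (() , _)
LtoBw∘BwtoL-bounded zero    (node _ _ _) () _
LtoBw∘BwtoL-bounded (suc n) T@(node _ _ _) T≤ bw = byLeftmost refl
  where
  open ≡-Reasoning
  T′ = removeLeftmost T

  byLeftmost : ∀ {x} → leftmost T ≡ x → LtoBw (BwtoL T) ≡ T
  byLeftmost {nothing} eq with leftmost≡nothing⇒leaf T eq
  ... | ()
  byLeftmost {just (black , _)} eq with blackLeftmost⇒spine T (proj₂ bw) eq
  ... | k , T≡spine = subst (λ t → LtoBw (BwtoL t) ≡ t) (sym T≡spine) (LtoBw∘BwtoL-spine k)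
  byLeftmost {just (white , leaf)} eq = begin
    LtoBw (BwtoL T)                                      ≡⟨ cong (LtoBw ∘ BwtoL) (sym T≡) ⟩
    LtoBw (BwtoL (addLeftmost (single white) T′))        ≡⟨ cong LtoBw (BwtoL-lam T′) ⟩
    addLeftmost (single white) (LtoBw (BwtoL T′))        ≡⟨ cong (addLeftmost _) ih ⟩
    addLeftmost (single white) T′                        ≡⟨ T≡ ⟩
    T                                                    ∎
    where
    T≡ = addLeftmost-removeLeftmost T eq
    ih = LtoBw∘BwtoL-bounded n T′ (proj₂ (leftmost-parts-smaller T eq T≤)) (IsBW-removeLeftmost T bw eq)
  byLeftmost {just (white , r@(node _ _ _))} eq = begin
    LtoBw (BwtoL T)                                      ≡⟨ cong (LtoBw ∘ BwtoL) (sym T≡) ⟩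
    LtoBw (BwtoL (addLeftmost (node white leaf r) T′))   ≡⟨ cong LtoBw (BwtoL-app r T′ (λ ())) ⟩
    addLeftmost (node white leaf (LtoBw (BwtoL r))) (LtoBw (BwtoL T′))
                                                         ≡⟨ cong₂ (addLeftmost ∘ node white leaf) ih-r ih-T′ ⟩
    addLeftmost (node white leaf r) T′                   ≡⟨ T≡ ⟩
    T                                                    ∎
    where
    T≡ = addLeftmost-removeLeftmost T eq
    parts≤ = leftmost-parts-smaller T eq T≤
    ih-r  = LtoBw∘BwtoL-bounded n r (proj₁ parts≤) (IsBW-leftmostRight T (proj₂ bw) eq)
    ih-T′ = LtoBw∘BwtoL-bounded n T′ (proj₂ parts≤) (IsBW-removeLeftmost T bw eq)

proposition1 : ((M : Term) → BwtoL (LtoBw M) ≡ M)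
               × ((T : BT) → IsBW T → LtoBw (BwtoL T) ≡ T)
proposition1 = BwtoL∘LtoBw , λ T → LtoBw∘BwtoL-bounded (size T) T ≤-refl
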